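{- Let $\tau\ge 2$ be an odd integer and let $e\ge 1$ be an even integer. Then $$2\cdot 3^{\tau-1}-1\neq \frac{(2^{\tau}-1)2^e-1}{3}.$$ -}

module Defs where

open import Data.Nat using (ℕ; _*_; suc)
open import Data.Product using (∃)
open import Relation.Binary.PropositionalEquality using (_≡_)

Even : ℕ → Set
Even n = ∃ λ k → n ≡ 2 * k

Odd : ℕ → Set
Odd n = ∃ λ k → n ≡ suc (2 * k)

-- With τ = 2t + 1 and e = 2s, clearing the denominator turns the equation into
-- 6·9^t + 4^s = 2·4^t·4^s + 2 over ℕ. For t, s ≥ 1 the right side is 2 modulo 16,
-- whereas 9^t ≡ 1 (mod 8) makes the left side 10 (s = 1) or 6 (s ≥ 2) modulo 16.
module Submission where

open import Defs
open import Data.Nat using (ℕ; _≥_; _^_; _∸_)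
open import Data.Integer using (ℤ; +_; _-_; _*_)
open import Data.Rational using (ℚ; _/_)
open import Relation.Binary.PropositionalEquality using (_≢_)

open import Data.Nat as ℕ using (zero; suc; s≤s; NonZero)
open import Data.Nat.DivMod using (_%_; [m+kn]%n≡m%n)
import Data.Nat.Properties as ℕ
import Data.Integer as ℤ
import Data.Integer.Properties as ℤ
open import Data.Rational.Unnormalised using (mkℚᵘ; *≡*)
open import Data.Rational.Properties using (/-injective-≃)
open import Data.Product using (∃-syntax; _,_)
open import Relation.Binary.PropositionalEquality
open import Relation.Nullary using (contradiction)
import Data.Nat.Tactic.RingSolver as ℕ-Solver
import Data.Integer.Tactic.RingSolver as ℤ-Solver

[1+m]^n≡1+k*m : ∀ m n → ∃[ k ] suc m ^ n ≡ 1 ℕ.+ k ℕ.* m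
[1+m]^n≡1+k*m m zero = 0 , refl
[1+m]^n≡1+k*m m (suc n) with k , eq ← [1+m]^n≡1+k*m m n =
  1 ℕ.+ k ℕ.* (1 ℕ.+ m) , trans (cong (suc m ℕ.*_) eq) (expand m k)
  where
  expand : ∀ m k → (1 ℕ.+ m) ℕ.* (1 ℕ.+ k ℕ.* m) ≡ 1 ℕ.+ (1 ℕ.+ k ℕ.* (1 ℕ.+ m)) ℕ.* m
  expand = ℕ-Solver.solve-∀

≡m+kn⇒%n≡m%n : ∀ {i} m k n .{{_ : NonZero n}} → i ≡ m ℕ.+ k ℕ.* n → i % n ≡ m % n
≡m+kn⇒%n≡m%n m k n refl = [m+kn]%n≡m%n m k n

[6*9^t+4^[1+s]]%16≢2 : ∀ t s → (6 ℕ.* 9 ^ t ℕ.+ 4 ^ suc s) % 16 ≢ 2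
[6*9^t+4^[1+s]]%16≢2 t s with k , 9^t≡1+k*8 ← [1+m]^n≡1+k*m 8 t rewrite 9^t≡1+k*8 = residue s
  where
  at-4^1 : ∀ k → 6 ℕ.* (1 ℕ.+ k ℕ.* 8) ℕ.+ 4 ^ 1 ≡ 10 ℕ.+ 3 ℕ.* k ℕ.* 16
  at-4^1 = ℕ-Solver.solve-∀
  at-4^[2+r] : ∀ k x → 6 ℕ.* (1 ℕ.+ k ℕ.* 8) ℕ.+ 4 ℕ.* (4 ℕ.* x) ≡ 6 ℕ.+ (3 ℕ.* k ℕ.+ x) ℕ.* 16
  at-4^[2+r] = ℕ-Solver.solve-∀
  residue : ∀ s → (6 ℕ.* (1 ℕ.+ k ℕ.* 8) ℕ.+ 4 ^ suc s) % 16 ≢ 2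
  residue zero h = contradiction (trans (sym (≡m+kn⇒%n≡m%n 10 (3 ℕ.* k) 16 (at-4^1 k))) h) λ ()
  residue (suc r) h =
    contradiction (trans (sym (≡m+kn⇒%n≡m%n 6 (3 ℕ.* k ℕ.+ 4 ^ r) 16 (at-4^[2+r] k (4 ^ r)))) h) λ ()

[2*4^[1+t]*4^[1+s]+2]%16≡2 : ∀ t s → (2 ℕ.* 4 ^ suc t ℕ.* 4 ^ suc s ℕ.+ 2) % 16 ≡ 2
[2*4^[1+t]*4^[1+s]+2]%16≡2 t s = ≡m+kn⇒%n≡m%n 2 (2 ℕ.* 4 ^ t ℕ.* 4 ^ s) 16 (regroup (4 ^ t) (4 ^ s))
  where
  regroup : ∀ x y → 2 ℕ.* (4 ℕ.* x) ℕ.* (4 ℕ.* y) ℕ.+ 2 ≡ 2 ℕ.+ 2 ℕ.* x ℕ.* y ℕ.* 16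
  regroup = ℕ-Solver.solve-∀

6*9^[1+t]+4^[1+s]≢2*4^[1+t]*4^[1+s]+2 : ∀ t s →
  6 ℕ.* 9 ^ suc t ℕ.+ 4 ^ suc s ≢ 2 ℕ.* 4 ^ suc t ℕ.* 4 ^ suc s ℕ.+ 2
6*9^[1+t]+4^[1+s]≢2*4^[1+t]*4^[1+s]+2 t s eq =
  [6*9^t+4^[1+s]]%16≢2 (suc t) s (trans (cong (_% 16) eq) ([2*4^[1+t]*4^[1+s]+2]%16≡2 t s))

pos-^ : ∀ m n → + (m ^ n) ≡ (+ m) ℤ.^ n
pos-^ m zero = refl
pos-^ m (suc n) = trans (ℤ.pos-* m (m ^ n)) (cong (+ m *_) (pos-^ m n))

+m^[2*n]≡+[m^2]^n : ∀ m n → (+ m) ℤ.^ (2 ℕ.* n) ≡ + ((m ^ 2) ^ n)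
+m^[2*n]≡+[m^2]^n m n = trans (sym (pos-^ m (2 ℕ.* n))) (cong +_ (sym (ℕ.^-*-assoc m 2 n)))

/-cross-multiply : ∀ p q m n → p / suc m ≡ q / suc n → p * + suc n ≡ q * + suc m
/-cross-multiply p q m n eq with *≡* h ← /-injective-≃ (mkℚᵘ p m) (mkℚᵘ q n) eq = h

cleared-equation : ∀ {A C D a c d} → A ≡ + a → C ≡ + c → D ≡ + d →
  (+ 2 * A - + 1) * + 3 ≡ ((+ 2 * C - + 1) * D - + 1) * + 1 →
  6 ℕ.* a ℕ.+ d ≡ 2 ℕ.* c ℕ.* d ℕ.+ 2
cleared-equation {a = a} {c} {d} refl refl refl h = ℤ.+-injective (begin
  + (6 ℕ.* a ℕ.+ d)                                        ≡⟨ embed-left ⟩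
  + 6 * + a ℤ.+ + d                                        ≡⟨ shift-left (+ a) (+ d) ⟩
  (+ 2 * + a - + 1) * + 3 ℤ.+ (+ d ℤ.+ + 3)                 ≡⟨ cong (ℤ._+ (+ d ℤ.+ + 3)) h ⟩
  ((+ 2 * + c - + 1) * + d - + 1) * + 1 ℤ.+ (+ d ℤ.+ + 3)   ≡⟨ shift-right (+ c) (+ d) ⟩
  + 2 * + c * + d ℤ.+ + 2                                  ≡⟨ embed-right ⟨
  + (2 ℕ.* c ℕ.* d ℕ.+ 2)                                  ∎)
  where
  open ≡-Reasoning
  embed-left : + (6 ℕ.* a ℕ.+ d) ≡ + 6 * + a ℤ.+ + d
  embed-left = trans (ℤ.pos-+ (6 ℕ.* a) d) (cong (ℤ._+ + d) (ℤ.pos-* 6 a))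
  embed-right : + (2 ℕ.* c ℕ.* d ℕ.+ 2) ≡ + 2 * + c * + d ℤ.+ + 2
  embed-right = trans (ℤ.pos-+ (2 ℕ.* c ℕ.* d) 2)
    (cong (ℤ._+ + 2) (trans (ℤ.pos-* (2 ℕ.* c) d) (cong (_* + d) (ℤ.pos-* 2 c))))
  shift-left : ∀ x z → + 6 * x ℤ.+ z ≡ (+ 2 * x - + 1) * + 3 ℤ.+ (z ℤ.+ + 3)
  shift-left = ℤ-Solver.solve-∀
  shift-right : ∀ y z → ((+ 2 * y - + 1) * z - + 1) * + 1 ℤ.+ (z ℤ.+ + 3) ≡ + 2 * y * z ℤ.+ + 2
  shift-right = ℤ-Solver.solve-∀

mainTheorem2 : (τ e : ℕ) → τ ≥ 2 → Odd τ → e ≥ 1 → Even e →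
    ((+ 2 * (+ 3) Data.Integer.^ (τ ∸ 1) - + 1) / 1)
      ≢ (((+ 2) Data.Integer.^ τ - + 1) * (+ 2) Data.Integer.^ e - + 1) / 3
mainTheorem2 _ _ (s≤s ()) (zero , refl) _ _
mainTheorem2 _ _ _ _ () (zero , refl)
mainTheorem2 _ _ _ (suc t , refl) _ (suc s , refl) eq =
  6*9^[1+t]+4^[1+s]≢2*4^[1+t]*4^[1+s]+2 t s
    (cleared-equation (+m^[2*n]≡+[m^2]^n 3 (suc t)) (+m^[2*n]≡+[m^2]^n 2 (suc t)) (+m^[2*n]≡+[m^2]^n 2 (suc s))
      (/-cross-multiply numerator-left numerator-right 0 2 eq))
  where
  numerator-left numerator-right : ℤ
  numerator-left = + 2 * (+ 3) ℤ.^ (2 ℕ.* suc t) - + 1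
  numerator-right = ((+ 2) ℤ.^ suc (2 ℕ.* suc t) - + 1) * (+ 2) ℤ.^ (2 ℕ.* suc s) - + 1
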